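{- Let $\Omega$ be an infinite set and let $f$ and $g$ be partial-bijections of $\Omega$. Then $\operatorname{ind}(g \circ f) = \operatorname{ind}(g) + \operatorname{ind}(f)$.
   Context: Let $\Omega$ be an infinite set. For $C \subseteq \Omega$ write $C' = \Omega \setminus C$ and $|C|$ for its cardinality. A partial-bijection of $\Omega$ is a bijection $f : A_f \to B_f$ where $A_f, B_f \subseteq \Omega$ are cofinite subsets. The index of $f$ is $\operatorname{ind}(f) = |A_f'| - |B_f'| \in \mathbb{Z}$. For partial-bijections $f : A_f \to B_f$ and $g : A_g \to B_g$, the composite $g \circ f$ is the partial-bijection with domain $A_{g\circ f} = f^{ -1}(B_f \cap A_g)$ (preimage under $f$), codomain $B_{g\circ f} = g(B_f \cap A_g)$, and rule $(g\circ f)(\omega) = g(f(\omega))$. -}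

module Defs where

open import Data.Nat using (ℕ)
open import Data.Integer using (ℤ; +_; _-_)
open import Data.List using (List; length)
open import Data.List.Membership.Propositional using (_∈_; _∉_)
open import Data.List.Relation.Unary.Unique.Propositional using (Unique)
open import Data.Product using (Σ; Σ-syntax; ∃; ∃-syntax; _×_; _,_)
open import Function.Bundles using (_⇔_)
open import Relation.Binary.PropositionalEquality using (_≡_)
open import Relation.Nullary using (¬_)

Infinite : Set → Set
Infinite Ω = (xs : List Ω) → ∃[ ω ] (ω ∉ xs)

Subset : Set → Set₁
Subset Ω = Ω → Set

_′ : {Ω : Set} → Subset Ω → Subset Ω
(C ′) ω = ¬ C ω

record FinEnum {Ω : Set} (C : Subset Ω) : Set where
  field
    elems  : List Ω
    unique : Unique elems
    exact  : (ω : Ω) → (ω ∈ elems) ⇔ C ω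

open FinEnum public

card : {Ω : Set} {C : Subset Ω} → FinEnum C → ℕ
card e = length (elems e)

Cofinite : {Ω : Set} → Subset Ω → Set
Cofinite C = FinEnum (C ′)

record PartialBijection (Ω : Set) : Set₁ where
  field
    dom     : Subset Ω
    cod     : Subset Ω
    domCof  : Cofinite dom
    codCof  : Cofinite cod
    fun     : (ω : Ω) → dom ω → Ω
    fun-irr : ∀ ω (p q : dom ω) → fun ω p ≡ fun ω q
    fun-cod : ∀ ω (p : dom ω) → cod (fun ω p)
    inj     : ∀ ω ω′ (p : dom ω) (q : dom ω′) → fun ω p ≡ fun ω′ q → ω ≡ ω′
    surj    : ∀ y → cod y → ∃[ ω ] Σ[ p ∈ dom ω ] (fun ω p ≡ y)

open PartialBijection public

ind : {Ω : Set} → PartialBijection Ω → ℤ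
ind f = + card (domCof f) - + card (codCof f)

compDom : {Ω : Set} → PartialBijection Ω → PartialBijection Ω → Subset Ω
compDom g f ω = Σ[ p ∈ dom f ω ] (cod f (fun f ω p) × dom g (fun f ω p))

compCod : {Ω : Set} → PartialBijection Ω → PartialBijection Ω → Subset Ω
compCod g f y = ∃[ x ] Σ[ b ∈ cod f x ] Σ[ a ∈ dom g x ] (fun g x a ≡ y)

compFun : {Ω : Set} (g f : PartialBijection Ω) → (ω : Ω) → compDom g f ω → Ω
compFun g f ω (p , _ , q) = fun g (fun f ω p) q

-- Write X = A_{g∘f}′ and Y = B_{g∘f}′; the claim is |X| + |B_g′| + |B_f′| = |Y| + |A_g′| + |A_f′|.
-- The left-hand sets inject into the right-hand ones: x ∈ X goes to f x ∈ A_g′ if x ∈ A_f and to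
-- x ∈ A_f′ otherwise, y ∈ B_g′ goes to y ∈ Y, and y ∈ B_f′ goes to g y ∈ Y if y ∈ A_g and to
-- y ∈ A_g′ otherwise.  The same injection for g⁻¹ and f⁻¹, whose composite is (g ∘ f)⁻¹, gives
-- the reverse inequality.  Membership in A_f and A_g is undecidable, so the injections exist only
-- under double negation; this suffices because ≤ on ℕ is decidable.

module Submission where

open import Defs
open import Data.Integer using (+_; _-_; _+_)
open import Relation.Binary.PropositionalEquality using (_≡_)

open import Data.Empty using (⊥)
open import Data.Integer.Properties using (i-j≡0⇒i≡j; pos-+; +-inverseʳ)
open import Data.Integer.Tactic.RingSolver using (solve-∀)
open import Data.List using (List; []; _∷_; length; map; _++_)
open import Data.List.Membership.Propositional using (_∈_; _─_)
open import Data.List.Membership.Propositional.Properties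
  using (∈-map⁺; ∈-map⁻; ∈-++⁺ˡ; ∈-++⁺ʳ; ∈-++⁻)
open import Data.List.Properties using (length-++; length-map; length-removeAt′)
open import Data.List.Relation.Unary.All using (lookup)
open import Data.List.Relation.Unary.AllPairs using (_∷_)
open import Data.List.Relation.Unary.Any using (here; there; index)
open import Data.List.Relation.Unary.Unique.Propositional using (Unique)
import Data.List.Relation.Unary.Unique.Propositional.Properties as Unique
open import Data.Nat as ℕ using (suc; _≤_; z≤n; s≤s; _≤?_)
open import Data.Nat.Properties using (≤-antisym; +-comm)
open import Data.Product using (Σ-syntax; ∃-syntax; _×_; _,_; proj₁; proj₂)
open import Data.Sum using (_⊎_; inj₁; inj₂)
open import Data.Sum.Properties using (inj₁-injective; inj₂-injective)
open import Function using (_∘_)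
open import Function.Bundles using (_⇔_; mk⇔; Equivalence)
open import Relation.Binary.PropositionalEquality
  using (refl; sym; trans; cong; cong₂; subst; subst₂; module ≡-Reasoning)
open import Relation.Nullary using (¬_)
open import Relation.Nullary.Decidable using (decidable-stable)
open import Relation.Nullary.Negation using (¬¬-map; contradiction)
open import Relation.Unary using (_⟨⊎⟩_)

¬¬-cases : {P Q : Set} → (P → Q) → (¬ P → Q) → ¬ ¬ Q
¬¬-cases onP on¬P ¬q = ¬q (on¬P (λ p → ¬q (onP p)))

module _ {A B : Set} where

  ∈-─⁺ : ∀ {b c} {M : List B} (b∈M : b ∈ M) → c ∈ M → ¬ c ≡ b → c ∈ M ─ b∈M
  ∈-─⁺ (here refl) (here refl) c≢b = contradiction refl c≢b
  ∈-─⁺ (here _)    (there c∈M) _   = c∈M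
  ∈-─⁺ (there _)   (here refl) _   = here refl
  ∈-─⁺ (there b∈M) (there c∈M) c≢b = there (∈-─⁺ b∈M c∈M c≢b)

  length-≤-of-injection : (R : A → B → Set) {L : List A} {M : List B} → Unique L
    → (∀ {a} → a ∈ L → ¬ ¬ (∃[ b ] (b ∈ M × R a b)))
    → (∀ {a a′ b} → a ∈ L → a′ ∈ L → R a b → R a′ b → a ≡ a′)
    → length L ≤ length M
  length-≤-of-injection R {[]}    _              _     _         = z≤n
  length-≤-of-injection R {a ∷ L} {M} (a∉L ∷ uniqueL) total injective =
    decidable-stable (suc (length L) ≤? length M) (¬¬-map room-after-a (total (here refl)))
    where
    room-after-a : ∃[ b ] (b ∈ M × R a b) → suc (length L) ≤ length M
    room-after-a (b , b∈M , Rab) =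
      subst (suc (length L) ≤_) (sym (length-removeAt′ M (index b∈M)))
        (s≤s (length-≤-of-injection R uniqueL total′ (λ a∈ a′∈ → injective (there a∈) (there a′∈))))
      where
      total′ : ∀ {a′} → a′ ∈ L → ¬ ¬ (∃[ c ] (c ∈ M ─ b∈M × R a′ c))
      total′ a′∈L = ¬¬-map
        (λ (c , c∈M , Ra′c) → c , ∈-─⁺ b∈M c∈M
          (λ { refl → lookup a∉L a′∈L (sym (injective (there a′∈L) (here refl) Ra′c Rab)) }) , Ra′c)
        (total (there a′∈L))

module _ {A : Set} {C : Subset A} (e : FinEnum C) where

  ∈-enum⁻ : ∀ {a} → a ∈ elems e → C a
  ∈-enum⁻ = Equivalence.to (exact e _)

  ∈-enum⁺ : ∀ {a} → C a → a ∈ elems e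
  ∈-enum⁺ = Equivalence.from (exact e _)

module _ {A B : Set} {C : Subset A} {D : Subset B} where

  card-≤-of-injection : (eC : FinEnum C) (eD : FinEnum D) (R : A → B → Set)
    → (∀ {a} → C a → ¬ ¬ (∃[ b ] (D b × R a b)))
    → (∀ {a a′ b} → C a → C a′ → R a b → R a′ b → a ≡ a′)
    → card eC ≤ card eD
  card-≤-of-injection eC eD R total injective =
    length-≤-of-injection R (unique eC)
      (λ a∈ → ¬¬-map (λ (b , Db , Rab) → b , ∈-enum⁺ eD Db , Rab) (total (∈-enum⁻ eC a∈)))
      (λ a∈ a′∈ → injective (∈-enum⁻ eC a∈) (∈-enum⁻ eC a′∈))

  infixr 4 _⊎-enum_

  _⊎-enum_ : FinEnum C → FinEnum D → FinEnum (C ⟨⊎⟩ D)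
  eC ⊎-enum eD = record
    { elems  = map inj₁ (elems eC) ++ map inj₂ (elems eD)
    ; unique = Unique.++⁺ (Unique.map⁺ inj₁-injective (unique eC))
                          (Unique.map⁺ inj₂-injective (unique eD))
                          disjoint
    ; exact  = λ where
        (inj₁ a) → mk⇔ (∈-enum⁻ eC ∘ ∈-inj₁⁻) (λ Ca → ∈-++⁺ˡ (∈-map⁺ inj₁ (∈-enum⁺ eC Ca)))
        (inj₂ b) → mk⇔ (∈-enum⁻ eD ∘ ∈-inj₂⁻) (λ Db → ∈-++⁺ʳ _ (∈-map⁺ inj₂ (∈-enum⁺ eD Db)))
    }
    where
    disjoint : ∀ {v} → ¬ (v ∈ map inj₁ (elems eC) × v ∈ map inj₂ (elems eD))
    disjoint (v∈₁ , v∈₂) with ∈-map⁻ inj₁ v∈₁ | ∈-map⁻ inj₂ v∈₂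
    ... | _ , _ , refl | _ , _ , ()
    ∈-inj₁⁻ : ∀ {a} → inj₁ a ∈ map inj₁ (elems eC) ++ map inj₂ (elems eD) → a ∈ elems eC
    ∈-inj₁⁻ a∈ with ∈-++⁻ (map inj₁ (elems eC)) a∈
    ... | inj₁ a∈₁ with _ , a∈C , refl ← ∈-map⁻ inj₁ a∈₁ = a∈C
    ... | inj₂ a∈₂ with _ , _ , () ← ∈-map⁻ inj₂ a∈₂
    ∈-inj₂⁻ : ∀ {b} → inj₂ b ∈ map inj₁ (elems eC) ++ map inj₂ (elems eD) → b ∈ elems eD
    ∈-inj₂⁻ b∈ with ∈-++⁻ (map inj₁ (elems eC)) b∈
    ... | inj₁ b∈₁ with _ , _ , () ← ∈-map⁻ inj₁ b∈₁
    ... | inj₂ b∈₂ with _ , b∈D , refl ← ∈-map⁻ inj₂ b∈₂ = b∈D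

  card-⊎ : (eC : FinEnum C) (eD : FinEnum D) → card (eC ⊎-enum eD) ≡ card eC ℕ.+ card eD
  card-⊎ eC eD = trans (length-++ (map inj₁ (elems eC)))
                       (cong₂ ℕ._+_ (length-map inj₁ (elems eC)) (length-map inj₂ (elems eD)))

module _ {A : Set} where

  FinEnum-⇔ : {C D : Subset A} → (∀ a → C a ⇔ D a) → FinEnum C → FinEnum D
  FinEnum-⇔ C⇔D e = record
    { elems  = elems e
    ; unique = unique e
    ; exact  = λ a → mk⇔ (Equivalence.to (C⇔D a) ∘ ∈-enum⁻ e) (∈-enum⁺ e ∘ Equivalence.from (C⇔D a))
    }

  Cofinite-⇔ : {C D : Subset A} → (∀ a → C a ⇔ D a) → Cofinite C → Cofinite D
  Cofinite-⇔ C⇔D = FinEnum-⇔ (λ a → mk⇔ (λ ¬Ca Da → ¬Ca (Equivalence.from (C⇔D a) Da))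
                                         (λ ¬Da Ca → ¬Da (Equivalence.to (C⇔D a) Ca)))

module _ {Ω : Set} where

  Maps : PartialBijection Ω → Ω → Ω → Set
  Maps h x y = Σ[ p ∈ dom h x ] fun h x p ≡ y

  module _ (h : PartialBijection Ω) {x x′ y y′ : Ω} where

    Maps-functional : Maps h x y → Maps h x′ y′ → x ≡ x′ → y ≡ y′
    Maps-functional (p , hx≡y) (p′ , hx′≡y′) refl = trans (sym hx≡y) (trans (fun-irr h x p p′) hx′≡y′)

    Maps-injective : Maps h x y → Maps h x′ y′ → y ≡ y′ → x ≡ x′
    Maps-injective (p , hx≡y) (p′ , hx′≡y′) refl = inj h x x′ p p′ (trans hx≡y (sym hx′≡y′))

  Maps-cod : (h : PartialBijection Ω) {x y : Ω} → Maps h x y → cod h y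
  Maps-cod h (p , refl) = fun-cod h _ p

  inverse : PartialBijection Ω → PartialBijection Ω
  inverse h = record
    { dom     = cod h
    ; cod     = dom h
    ; domCof  = codCof h
    ; codCof  = domCof h
    ; fun     = λ y c → proj₁ (surj h y c)
    ; fun-irr = λ y c c′ → Maps-injective h (proj₂ (surj h y c)) (proj₂ (surj h y c′)) refl
    ; fun-cod = λ y c → proj₁ (proj₂ (surj h y c))
    ; inj     = λ y y′ c c′ → Maps-functional h (proj₂ (surj h y c)) (proj₂ (surj h y′ c′))
    ; surj    = λ x p → fun h x p , fun-cod h x p
                      , Maps-injective h (proj₂ (surj h (fun h x p) (fun-cod h x p))) (p , refl) refl
    }

  module _ (f g : PartialBijection Ω) where

    compDom-inverse : ∀ x → compDom g f x ⇔ compCod (inverse f) (inverse g) x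
    compDom-inverse x = mk⇔ to from
      where
      to : compDom g f x → compCod (inverse f) (inverse g) x
      to (p , b , a) = fun f x p , a , b , Maps-injective f (proj₂ (surj f _ b)) (p , refl) refl
      from : compCod (inverse f) (inverse g) x → compDom g f x
      from (z , a , b , refl) with surj f z b
      ... | _ , p , refl = p , b , a

    compCod-inverse : ∀ y → compCod g f y ⇔ compDom (inverse f) (inverse g) y
    compCod-inverse y = mk⇔ to from
      where
      to : compCod g f y → compDom (inverse f) (inverse g) y
      to (x , b , a , gx≡y) = c , proj₁ (proj₂ (surj g y c)) , subst (cod f) (sym x′≡x) b
        where
        c : cod g y
        c = Maps-cod g (a , gx≡y)
        x′≡x : proj₁ (surj g y c) ≡ x
        x′≡x = Maps-injective g (proj₂ (surj g y c)) (a , gx≡y) refl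
      from : compDom (inverse f) (inverse g) y → compCod g f y
      from (c , _ , b) = proj₁ (surj g y c) , b , proj₂ (surj g y c)

  pattern ι₀ x = inj₁ x
  pattern ι₁ x = inj₂ (inj₁ x)
  pattern ι₂ x = inj₂ (inj₂ x)

  module GapInjection (f g : PartialBijection Ω) where

    Gapsˡ Gapsʳ : Subset (Ω ⊎ (Ω ⊎ Ω))
    Gapsˡ = (compDom g f ′) ⟨⊎⟩ (cod g ′) ⟨⊎⟩ (cod f ′)
    Gapsʳ = (compCod g f ′) ⟨⊎⟩ (dom g ′) ⟨⊎⟩ (dom f ′)

    Step : Ω ⊎ (Ω ⊎ Ω) → Ω ⊎ (Ω ⊎ Ω) → Set
    Step (ι₀ x) (ι₁ y) = Maps f x y
    Step (ι₀ x) (ι₂ y) = x ≡ y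
    Step (ι₁ y) (ι₀ z) = y ≡ z
    Step (ι₂ y) (ι₀ z) = Maps g y z
    Step (ι₂ y) (ι₁ z) = y ≡ z
    Step _      _      = ⊥

    Step-total : ∀ {u} → Gapsˡ u → ¬ ¬ (∃[ v ] (Gapsʳ v × Step u v))
    Step-total {ι₀ x} x∉A = ¬¬-cases
      (λ p → ι₁ (fun f x p) , (λ q → x∉A (p , fun-cod f x p , q)) , p , refl)
      (λ x∉Af → ι₂ x , x∉Af , refl)
    Step-total {ι₁ y} y∉Bg = contradiction
      (ι₀ y , (λ (x , _ , q , gx≡y) → y∉Bg (Maps-cod g (q , gx≡y))) , refl)
    Step-total {ι₂ y} y∉Bf = ¬¬-cases
      (λ q → ι₀ (fun g y q)
           , (λ (x , x∈Bf , q′ , gx≡gy) →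
                y∉Bf (subst (cod f) (Maps-injective g (q′ , gx≡gy) (q , refl) refl) x∈Bf))
           , q , refl)
      (λ y∉Ag → ι₁ y , y∉Ag , refl)

    Step-injective : ∀ {u u′ v} → Gapsˡ u → Gapsˡ u′ → Step u v → Step u′ v → u ≡ u′
    Step-injective {ι₀ _} {ι₀ _} {ι₁ _} _ _ fx≡y fx′≡y = cong ι₀ (Maps-injective f fx≡y fx′≡y refl)
    Step-injective {ι₀ x} {ι₂ _} {ι₁ _} _ y∉Bf (p , refl) refl = contradiction (fun-cod f x p) y∉Bf
    Step-injective {ι₂ _} {ι₀ x} {ι₁ _} y∉Bf _ refl (p , refl) = contradiction (fun-cod f x p) y∉Bf
    Step-injective {ι₂ _} {ι₂ _} {ι₁ _} _ _ refl refl = refl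
    Step-injective {ι₀ _} {ι₀ _} {ι₂ _} _ _ refl refl = refl
    Step-injective {ι₁ _} {ι₁ _} {ι₀ _} _ _ refl refl = refl
    Step-injective {ι₁ _} {ι₂ _} {ι₀ _} y∉Bg _ refl gy′≡y = contradiction (Maps-cod g gy′≡y) y∉Bg
    Step-injective {ι₂ _} {ι₁ _} {ι₀ _} _ y∉Bg gy≡y′ refl = contradiction (Maps-cod g gy≡y′) y∉Bg
    Step-injective {ι₂ _} {ι₂ _} {ι₀ _} _ _ gy≡z gy′≡z = cong ι₂ (Maps-injective g gy≡z gy′≡z refl)

  gaps-≤ : (f g : PartialBijection Ω) (eA : Cofinite (compDom g f)) (eB : Cofinite (compCod g f))
    → card eA ℕ.+ (card (codCof g) ℕ.+ card (codCof f)) ≤ card eB ℕ.+ (card (domCof g) ℕ.+ card (domCof f))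
  gaps-≤ f g eA eB = subst₂ _≤_ (card-⊎³ eA (codCof g) (codCof f)) (card-⊎³ eB (domCof g) (domCof f))
    (card-≤-of-injection (eA ⊎-enum codCof g ⊎-enum codCof f) (eB ⊎-enum domCof g ⊎-enum domCof f)
      Step Step-total Step-injective)
    where
    open GapInjection f g
    card-⊎³ : {C D E : Subset Ω} (eC : FinEnum C) (eD : FinEnum D) (eE : FinEnum E)
      → card (eC ⊎-enum eD ⊎-enum eE) ≡ card eC ℕ.+ (card eD ℕ.+ card eE)
    card-⊎³ eC eD eE = trans (card-⊎ eC (eD ⊎-enum eE)) (cong (card eC ℕ.+_) (card-⊎ eD eE))

  gaps-count : (f g : PartialBijection Ω) (eA : Cofinite (compDom g f)) (eB : Cofinite (compCod g f))
    → card eA ℕ.+ (card (codCof g) ℕ.+ card (codCof f)) ≡ card eB ℕ.+ (card (domCof g) ℕ.+ card (domCof f))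
  gaps-count f g eA eB = ≤-antisym (gaps-≤ f g eA eB)
    (subst₂ _≤_ (cong (card eB ℕ.+_) (+-comm (card (domCof f)) _))
                (cong (card eA ℕ.+_) (+-comm (card (codCof f)) _))
      (gaps-≤ (inverse g) (inverse f) (Cofinite-⇔ (compCod-inverse f g) eB)
                                      (Cofinite-⇔ (compDom-inverse f g) eA)))

difference-of-sums : ∀ a b c d e h → a ℕ.+ (d ℕ.+ h) ≡ b ℕ.+ (c ℕ.+ e)
  → + a - + b ≡ (+ c - + d) + (+ e - + h)
difference-of-sums a b c d e h sums≡ = i-j≡0⇒i≡j _ _ (begin
  (+ a - + b) - ((+ c - + d) + (+ e - + h))  ≡⟨ rearrange (+ a) (+ b) (+ c) (+ d) (+ e) (+ h) ⟩
  (+ a + (+ d + + h)) - (+ b + (+ c + + e))  ≡⟨ cong₂ _-_ (sum-pos a d h) (sum-pos b c e) ⟩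
  + (a ℕ.+ (d ℕ.+ h)) - + (b ℕ.+ (c ℕ.+ e)) ≡⟨ cong (λ n → + n - + (b ℕ.+ (c ℕ.+ e))) sums≡ ⟩
  + (b ℕ.+ (c ℕ.+ e)) - + (b ℕ.+ (c ℕ.+ e)) ≡⟨ +-inverseʳ (+ (b ℕ.+ (c ℕ.+ e))) ⟩
  + 0                                        ∎)
  where
  open ≡-Reasoning
  rearrange : ∀ a b c d e h → (a - b) - ((c - d) + (e - h)) ≡ (a + (d + h)) - (b + (c + e))
  rearrange = solve-∀
  sum-pos : ∀ m n k → + m + (+ n + + k) ≡ + (m ℕ.+ (n ℕ.+ k))
  sum-pos m n k = sym (trans (pos-+ m (n ℕ.+ k)) (cong (_+_ (+ m)) (pos-+ n k)))

theorem5 : {Ω : Set} → Infinite Ω → (f g : PartialBijection Ω)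
         → (eA : Cofinite (compDom g f)) → (eB : Cofinite (compCod g f))
         → (+ card eA - + card eB) ≡ ind g + ind f
theorem5 _ f g eA eB =
  difference-of-sums (card eA) (card eB) (card (domCof g)) (card (codCof g)) (card (domCof f)) (card (codCof f))
    (gaps-count f g eA eB)
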